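{- Let $G$ be a graph on the vertex set $V$ and let $S,S^*$ be subsets of $V$ with $S$ non-empty. Suppose that $W^S$ has rank $\geq|V|-1$. Then there is an automorphism $g$ of $G$ with $S^g=S^*$ (i.e. $\{g(v):v\in S\}=S^*$) if and only if ${\rm lex}(W^S)={\rm lex}(W^{S^*})$.
   Context: Graphs are finite, simple, undirected. For a graph $G$ on $V=\{v_1,\dots,v_n\}$ with adjacency matrix $A$ and $S\subseteq V$ with characteristic vector ${\rm e}\in\{0,1\}^n$, the walk matrix is $W^S=[{\rm e},A{\rm e},\dots,A^{n-1}{\rm e}]$. For a matrix $W$, ${\rm lex}(W)$ is the matrix obtained by permuting the rows of $W$ into lexicographical order. -}

module Defs where

open import Data.Bool using (Bool; true; false)
open import Data.Nat using (ℕ; zero; suc)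
import Data.Nat as ℕ
import Data.Nat.Properties as ℕP
open import Data.Fin using (Fin; toℕ)
open import Data.Fin.Subset using (Subset; _∈_)
open import Data.Vec using (lookup)
open import Data.List using (List; foldr)
import Data.List as List
open import Data.Product using (Σ; ∃; _×_; _,_)
open import Data.Integer using (+_)
open import Data.Rational using (ℚ; 0ℚ; _/_)
import Data.Rational as ℚ
open import Function.Bundles using (_⇔_)
open import Function.Definitions using (Injective)
open import Data.Fin.Permutation using (Permutation′; _⟨$⟩ʳ_)
open import Relation.Binary.PropositionalEquality using (_≡_)
open import Relation.Nullary using (¬_)
open import Data.List.Relation.Binary.Lex.NonStrict using (≤-decTotalOrder)
import Data.List.Sort as Sort

record Graph (n : ℕ) : Set where
  field
    adj       : Fin n → Fin n → Bool
    symmetric : ∀ u v → adj u v ≡ adj v u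
    loopless  : ∀ v → adj v v ≡ false

open Graph public

A : ∀ {n} → Graph n → Fin n → Fin n → ℕ
A G u v with adj G u v
... | true  = 1
... | false = 0

sumℕ : ∀ {n} → (Fin n → ℕ) → ℕ
sumℕ {n} f = foldr ℕ._+_ 0 (List.tabulate {n = n} f)

sumℚ : ∀ {n} → (Fin n → ℚ) → ℚ
sumℚ {n} f = foldr ℚ._+_ 0ℚ (List.tabulate {n = n} f)

-- characteristic vector e of S (Subset n = Vec Bool n, true = inside)
charVec : ∀ {n} → Subset n → Fin n → ℕ
charVec S v with lookup S v
... | true  = 1
... | false = 0

mulA : ∀ {n} → Graph n → (Fin n → ℕ) → (Fin n → ℕ)
mulA G x u = sumℕ (λ v → A G u v ℕ.* x v)

powA : ∀ {n} → Graph n → ℕ → (Fin n → ℕ) → (Fin n → ℕ)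
powA G zero    x = x
powA G (suc k) x = mulA G (powA G k x)

-- Walk matrix W^S = [e, Ae, ..., A^{n-1}e]; entry (i , j) = (A^j e)_i
walkMatrix : ∀ {n} → Graph n → Subset n → Fin n → Fin n → ℕ
walkMatrix G S i j = powA G (toℕ j) (charVec S) i

-- Rank (over ℚ) of an m×n matrix with natural entries is at least k:
-- there are k distinct columns which are linearly independent over ℚ.
toℚ : ℕ → ℚ
toℚ m = + m / 1

RankAtLeast : ∀ {m n} → (Fin m → Fin n → ℕ) → ℕ → Set
RankAtLeast {m} {n} M k =
  Σ (Fin k → Fin n) λ cols →
    Injective _≡_ _≡_ cols ×
    (∀ (c : Fin k → ℚ) →
       (∀ i → sumℚ (λ t → c t ℚ.* toℚ (M i (cols t))) ≡ 0ℚ) →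
       ∀ t → c t ≡ 0ℚ)

row : ∀ {m n} → (Fin m → Fin n → ℕ) → Fin m → List ℕ
row {n = n} M i = List.tabulate {n = n} (M i)

module LexSort = Sort (≤-decTotalOrder ℕP.≤-decTotalOrder)

lex : ∀ {m n} → (Fin m → Fin n → ℕ) → List (List ℕ)
lex {m} M = LexSort.sort (List.tabulate {n = m} (row M))

IsAutomorphism : ∀ {n} → Graph n → Permutation′ n → Set
IsAutomorphism G g = ∀ u v → adj G (g ⟨$⟩ʳ u) (g ⟨$⟩ʳ v) ≡ adj G u v

ImageIs : ∀ {n} → Permutation′ n → Subset n → Subset n → Set
ImageIs g S S* = ∀ w → (w ∈ S* ⇔ ∃ λ v → v ∈ S × g ⟨$⟩ʳ v ≡ w)

module Submission where

open import Defs
open import Data.Nat using (ℕ; _∸_)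
open import Data.Fin.Subset using (Subset; Nonempty)
open import Data.Fin.Permutation using (Permutation′)
open import Data.Product using (∃; _×_)
open import Function.Bundles using (_⇔_)
open import Relation.Binary.PropositionalEquality using (_≡_)

open import Algebra.Bundles using (CommutativeRing)
import Algebra.Properties.Semiring.Sum as SemiringSum
open import Data.Bool using (Bool; true; false)
open import Data.Empty using (⊥-elim)
open import Data.Fin using (Fin; zero; suc; toℕ; punchIn; inject₁; fromℕ; fromℕ<; cast)
import Data.Fin.Properties as FinP
open import Data.Fin.Permutation as Perm using (_⟨$⟩ʳ_; _⟨$⟩ˡ_)
open import Data.Fin.Subset using (_∈_)
import Data.Integer as ℤ
import Data.Integer.Properties as ℤP
open import Data.List as List using (List)
import Data.List.Properties as ListP
open import Data.List.Relation.Binary.Lex.NonStrict using (≤-decTotalOrder)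
open import Data.List.Relation.Binary.Permutation.Homogeneous using (onIndices)
open import Data.List.Relation.Binary.Permutation.Propositional
  using (_↭_; ↭-refl; ↭-prep; ↭-swap; ↭-trans; ↭-sym; ↭⇒↭ₛ; ↭⇒↭ₛ′)
import Data.List.Relation.Binary.Permutation.Setoid.Properties as SetoidPermutation
import Data.List.Relation.Binary.Pointwise as Pointwise
import Data.List.Relation.Unary.Sorted.TotalOrder.Properties as Sorted
open import Data.Nat as ℕ using (zero; suc; z≤n; s≤s)
import Data.Nat.Coprimality as Coprime
import Data.Nat.Properties as ℕP
open import Data.Product using (_,_; proj₁; proj₂)
open import Data.Rational as ℚ using (ℚ; 0ℚ; 1ℚ; _+_; _*_; -_; _-_; 1/_; _≤_; mkℚ; ≢-nonZero)
import Data.Rational.Properties as ℚP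
open import Data.Rational.Solver using (module +-*-Solver)
open import Data.Sum using (_⊎_; inj₁; inj₂)
open import Data.Vec using (lookup)
import Data.Vec.Properties as VecP
open import Data.Vec.Functional using (Vector; _∷_; []; insertAt)
open import Data.Vec.Functional.Properties using (insertAt-lookup; insertAt-punchIn)
open import Function using (_∘_)
open import Function.Bundles using (mk⇔; Equivalence)
open import Relation.Binary.Bundles using (DecTotalOrder)
open import Relation.Binary.PropositionalEquality using (refl; sym; trans; cong; cong₂; subst; setoid; module ≡-Reasoning)
open import Relation.Nullary using (yes; no; ¬_)
open import Relation.Nullary.Decidable using (decidable-stable; ¬?)

-- (⇒) An automorphism commutes with walks, so W^{S*} is W^S with its rows reindexed by
-- g⁻¹, and sorting the rows forgets the order.
-- (⇐) Equal sorted rows give a permutation σ of the vertices with W^S(σ i) = W^{S*}(i).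
-- Relabelling G along τ = σ⁻¹ yields a graph H with the same walk vectors A^j e (j < n)
-- as G.  Then D = A_H − A_G kills e, A e, …, A^{n−2} e, which are independent because
-- some n − 1 columns of the Krylov matrix W^S are; a symmetric matrix with zero diagonal
-- killing n − 1 independent vectors of ℚⁿ is 0, so H = G and τ is an automorphism;
-- column 0 shows S^τ = S*.

open SemiringSum (CommutativeRing.semiring ℚP.+-*-commutativeRing)
  using (sum; sum-cong-≗; sum-remove; sum-init-last; sum-replicate-zero; ∑-distrib-+; ∑-comm; *-distribˡ-sum; *-distribʳ-sum)

sum-zero : ∀ {n} (f : Vector ℚ n) → (∀ i → f i ≡ 0ℚ) → sum f ≡ 0ℚ
sum-zero {n} f f≡0 = trans (sum-cong-≗ f≡0) (sum-replicate-zero n)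

sum-weighted-comm : ∀ {k m} (a : Vector ℚ k) (b : Fin k → Fin m → ℚ) →
                    sum (λ s → a s * sum (b s)) ≡ sum (λ t → sum (λ s → a s * b s t))
sum-weighted-comm a b = trans (sum-cong-≗ (λ s → *-distribˡ-sum (a s) (b s))) (∑-comm (λ s t → a s * b s t))

zero-product : ∀ a b → a * b ≡ 0ℚ → ¬ (b ≡ 0ℚ) → a ≡ 0ℚ
zero-product a b ab≡0 b≢0 = begin
  a              ≡⟨ sym (ℚP.*-identityʳ a) ⟩
  a * 1ℚ         ≡⟨ cong (a *_) (sym (ℚP.*-inverseʳ b)) ⟩
  a * (b * 1/ b) ≡⟨ sym (ℚP.*-assoc a b (1/ b)) ⟩
  (a * b) * 1/ b ≡⟨ cong (_* 1/ b) ab≡0 ⟩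
  0ℚ * 1/ b      ≡⟨ ℚP.*-zeroˡ (1/ b) ⟩
  0ℚ             ∎
  where open ≡-Reasoning
        instance _ = ≢-nonZero b≢0

difference-zero : ∀ {x y} → x - y ≡ 0ℚ → x ≡ y
difference-zero {x} {y} x-y≡0 =
  trans (solve 2 (λ x y → x := (x :- y) :+ y) refl x y) (trans (cong (_+ y) x-y≡0) (ℚP.+-identityˡ y))
  where open +-*-Solver

_·_ : ∀ {m} → Vector ℚ m → Vector ℚ m → ℚ
x · y = sum (λ l → x l * y l)

infix 7 _·_

·-comm : ∀ {m} (x y : Vector ℚ m) → x · y ≡ y · x
·-comm x y = sum-cong-≗ (λ l → ℚP.*-comm (x l) (y l))

combo : ∀ {k m} → Vector ℚ k → (Fin k → Vector ℚ m) → Vector ℚ m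
combo c u l = sum (λ t → c t * u t l)

·-sub : ∀ {m} (x y z : Vector ℚ m) → (λ l → x l - y l) · z ≡ x · z - y · z
·-sub x y z = begin
  (λ l → x l - y l) · z                    ≡⟨ solve 2 (λ p q → p := (p :+ q) :- q) refl ((λ l → x l - y l) · z) (y · z) ⟩
  ((λ l → x l - y l) · z + y · z) - y · z  ≡⟨ cong (_- y · z) (sym (∑-distrib-+ (λ l → (x l - y l) * z l) (λ l → y l * z l))) ⟩
  sum (λ l → (x l - y l) * z l + y l * z l) - y · z ≡⟨ cong (_- y · z) (sum-cong-≗ (λ l →
                                                        solve 3 (λ p q r → (p :- q) :* r :+ q :* r := p :* r) refl (x l) (y l) (z l))) ⟩
  x · z - y · z                            ∎
  where open ≡-Reasoning
        open +-*-Solver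

Independent : ∀ {k m} → (Fin k → Vector ℚ m) → Set
Independent u = ∀ c → (∀ l → combo c u l ≡ 0ℚ) → ∀ t → c t ≡ 0ℚ

·-combo : ∀ {k m} (x : Vector ℚ m) (c : Vector ℚ k) (u : Fin k → Vector ℚ m) →
          x · combo c u ≡ sum (λ t → c t * (x · u t))
·-combo x c u = begin
  sum (λ l → x l * sum (λ t → c t * u t l))    ≡⟨ sum-weighted-comm x (λ l t → c t * u t l) ⟩
  sum (λ t → sum (λ l → x l * (c t * u t l)))  ≡⟨ sum-cong-≗ (λ t → trans (sum-cong-≗ (λ l → reorder (x l) (c t) (u t l)))
                                                                       (sym (*-distribˡ-sum (c t) (λ l → x l * u t l)))) ⟩
  sum (λ t → c t * (x · u t))                  ∎
  where
  open ≡-Reasoning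
  reorder : ∀ a b d → a * (b * d) ≡ b * (a * d)
  reorder = solve 3 (λ a b d → a :* (b :* d) := b :* (a :* d)) refl
    where open +-*-Solver

combo-combo : ∀ {j k m} (e : Vector ℚ j) (d : Fin j → Vector ℚ k) (u : Fin k → Vector ℚ m) l →
              combo e (λ s → combo (d s) u) l ≡ combo (combo e d) u l
combo-combo e d u l = begin
  sum (λ s → e s * sum (λ t → d s t * u t l))    ≡⟨ sum-weighted-comm e (λ s t → d s t * u t l) ⟩
  sum (λ t → sum (λ s → e s * (d s t * u t l)))  ≡⟨ sum-cong-≗ (λ t → trans (sum-cong-≗ (λ s → sym (ℚP.*-assoc (e s) (d s t) (u t l))))
                                                                         (sym (*-distribʳ-sum (u t l) (λ s → e s * d s t)))) ⟩
  sum (λ t → combo e d t * u t l)                ∎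
  where open ≡-Reasoning

drop-zero-coordinate : ∀ {k m} (u : Fin k → Vector ℚ (suc m)) → (∀ t → u t zero ≡ 0ℚ) →
                       Independent u → Independent (λ t l → u t (suc l))
drop-zero-coordinate u u₀≡0 ind c hc = ind c λ
  { zero    → sum-zero _ (λ t → trans (cong (c t *_) (u₀≡0 t)) (ℚP.*-zeroʳ (c t)))
  ; (suc l) → hc l }

-- Clearing the first coordinate with the pivot vector u p: the other vectors u ŝ
-- (ŝ = punchIn p s) are replaced by (u p)₀ · u ŝ − (u ŝ)₀ · u p.
reduce : ∀ {k m} → (Fin (suc k) → Vector ℚ (suc m)) → Fin (suc k) → Fin k → Vector ℚ (suc m)
reduce u p s l = u p zero * u (punchIn p s) l - u (punchIn p s) zero * u p l

reduce-cleared : ∀ {k m} (u : Fin (suc k) → Vector ℚ (suc m)) p s → reduce u p s zero ≡ 0ℚ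
reduce-cleared u p s = solve 2 (λ x y → x :* y :- y :* x := con 0ℚ) refl (u p zero) (u (punchIn p s) zero)
  where open +-*-Solver

-- Elimination with a nonzero pivot keeps the reduced vectors independent: a relation c′
-- among them lifts to the relation on u with coefficients c′ₛ · (u p)₀ at ŝ and
-- −Σₛ c′ₛ (u ŝ)₀ at p.
eliminate : ∀ {k m} (u : Fin (suc k) → Vector ℚ (suc m)) (p : Fin (suc k)) → ¬ (u p zero ≡ 0ℚ) →
            Independent u → Independent (λ s l → reduce u p s (suc l))
eliminate {k} {m} u p pivot≢0 ind c′ hc′ s =
  zero-product (c′ s) pivot (trans (sym (insertAt-punchIn g p a s)) (ind c combo≡0 (punchIn p s))) pivot≢0
  where
  pivot : ℚ
  pivot = u p zero
  û : Fin k → Vector ℚ (suc m)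
  û s = u (punchIn p s)
  g : Vector ℚ k
  g s = c′ s * pivot
  a : ℚ
  a = sum (λ s → - (c′ s * û s zero))
  c : Vector ℚ (suc k)
  c = insertAt g p a
  regroup : ∀ x y z w v → - (x * y) * z + x * w * v ≡ x * (w * v - y * z)
  regroup = solve 5 (λ x y z w v → :- (x :* y) :* z :+ x :* w :* v := x :* (w :* v :- y :* z)) refl
    where open +-*-Solver
  expand : ∀ l → combo c u l ≡ combo c′ (reduce u p) l
  expand l = begin
    combo c u l
      ≡⟨ sum-remove {i = p} (λ t → c t * u t l) ⟩
    c p * u p l + sum (λ s → c (punchIn p s) * û s l)
      ≡⟨ cong₂ _+_ (cong (_* u p l) (insertAt-lookup g p a))
                   (sum-cong-≗ (λ s → cong (_* û s l) (insertAt-punchIn g p a s))) ⟩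
    a * u p l + sum (λ s → g s * û s l)
      ≡⟨ cong (_+ sum (λ s → g s * û s l)) (*-distribʳ-sum (u p l) (λ s → - (c′ s * û s zero))) ⟩
    sum (λ s → - (c′ s * û s zero) * u p l) + sum (λ s → g s * û s l)
      ≡⟨ sym (∑-distrib-+ (λ s → - (c′ s * û s zero) * u p l) (λ s → g s * û s l)) ⟩
    sum (λ s → - (c′ s * û s zero) * u p l + g s * û s l)
      ≡⟨ sum-cong-≗ (λ s → regroup (c′ s) (û s zero) (u p l) pivot (û s l)) ⟩
    combo c′ (reduce u p) l ∎
    where open ≡-Reasoning
  combo≡0 : ∀ l → combo c u l ≡ 0ℚ
  combo≡0 zero    = trans (expand zero)
                      (sum-zero _ (λ s → trans (cong (c′ s *_) (reduce-cleared u p s)) (ℚP.*-zeroʳ (c′ s))))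
  combo≡0 (suc l) = trans (expand (suc l)) (hc′ l)

independent⇒≤ : ∀ m {k} (u : Fin k → Vector ℚ m) → Independent u → k ℕ.≤ m
independent⇒≤ _       {zero}  u ind = z≤n
independent⇒≤ zero    {suc k} u ind with ind (λ _ → 1ℚ) (λ ()) zero
... | ()
independent⇒≤ (suc m) {suc k} u ind with FinP.any? (λ p → ¬? (u p zero ℚP.≟ 0ℚ))
... | yes (p , pivot≢0) = s≤s (independent⇒≤ m (λ s l → reduce u p s (suc l)) (eliminate u p pivot≢0 ind))
... | no noPivot        = ℕP.m≤n⇒m≤1+n (independent⇒≤ m (λ t l → u t (suc l)) (drop-zero-coordinate u no-pivot ind))
  where
  no-pivot : ∀ p → u p zero ≡ 0ℚ
  no-pivot p = decidable-stable (u p zero ℚP.≟ 0ℚ) (λ u₀≢0 → noPivot (p , u₀≢0))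

InSpan : ∀ {k m} → (Fin k → Vector ℚ m) → Vector ℚ m → Set
InSpan u x = ∃ λ d → ∀ l → x l ≡ combo d u l

InSpan-resp : ∀ {k m} {u : Fin k → Vector ℚ m} {x y : Vector ℚ m} → (∀ l → x l ≡ y l) → InSpan u y → InSpan u x
InSpan-resp x≗y (d , y≡) = d , λ l → trans (x≗y l) (y≡ l)

unit : ∀ {k} → Fin k → Vector ℚ k
unit s t with s FinP.≟ t
... | yes _ = 1ℚ
... | no _  = 0ℚ

combo-unit : ∀ {k m} (u : Fin k → Vector ℚ m) s l → combo (unit s) u l ≡ u s l
combo-unit {suc k} u s l = begin
  combo (unit s) u l
    ≡⟨ sum-remove {i = s} (λ t → unit s t * u t l) ⟩
  unit s s * u s l + sum (λ t → unit s (punchIn s t) * u (punchIn s t) l)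
    ≡⟨ cong₂ _+_ (cong (_* u s l) unit-diagonal)
                 (sum-zero _ (λ t → trans (cong (_* u (punchIn s t) l) (unit-off-diagonal t)) (ℚP.*-zeroˡ (u (punchIn s t) l)))) ⟩
  1ℚ * u s l + 0ℚ
    ≡⟨ trans (ℚP.+-identityʳ _) (ℚP.*-identityˡ _) ⟩
  u s l ∎
  where
  open ≡-Reasoning
  unit-diagonal : unit s s ≡ 1ℚ
  unit-diagonal with s FinP.≟ s
  ... | yes _  = refl
  ... | no s≢s = ⊥-elim (s≢s refl)
  unit-off-diagonal : ∀ t → unit s (punchIn s t) ≡ 0ℚ
  unit-off-diagonal t with s FinP.≟ punchIn s t
  ... | yes s≡ŝ = ⊥-elim (FinP.punchInᵢ≢i s t (sym s≡ŝ))
  ... | no _    = refl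

member-inSpan : ∀ {k m} (u : Fin k → Vector ℚ m) s → InSpan u (u s)
member-inSpan u s = unit s , λ l → sym (combo-unit u s l)

combo-inSpan : ∀ {j k m} {u : Fin k → Vector ℚ m} (y : Fin j → Vector ℚ m) →
               (∀ s → InSpan u (y s)) → ∀ e → InSpan u (combo e y)
combo-inSpan {j} {k} {u = u} y y∈ e = combo e coords , λ l →
  trans (sum-cong-≗ (λ s → cong (e s *_) (proj₂ (y∈ s) l))) (combo-combo e coords u l)
  where
  coords : Fin j → Vector ℚ k
  coords s = proj₁ (y∈ s)

-- The span of k vectors contains at most k independent vectors: their coordinate
-- vectors in ℚᵏ are independent.
independent-inSpan⇒≤ : ∀ {K k m} (u : Fin k → Vector ℚ m) (w : Fin K → Vector ℚ m) →
                       (∀ t → InSpan u (w t)) → Independent w → K ℕ.≤ k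
independent-inSpan⇒≤ {K} {k} u w w∈ ind = independent⇒≤ k coords coords-independent
  where
  coords : Fin K → Vector ℚ k
  coords t = proj₁ (w∈ t)
  coords-independent : Independent coords
  coords-independent c hc = ind c λ l → begin
    combo c w l                         ≡⟨ sum-cong-≗ (λ t → cong (c t *_) (proj₂ (w∈ t) l)) ⟩
    combo c (λ t → combo (coords t) u) l ≡⟨ combo-combo c coords u l ⟩
    combo (combo c coords) u l           ≡⟨ sum-zero _ (λ s → trans (cong (_* u s l) (hc s)) (ℚP.*-zeroˡ (u s l))) ⟩
    0ℚ                                   ∎
    where open ≡-Reasoning

last-or-inject₁ : ∀ {k} (t : Fin (suc k)) → t ≡ fromℕ k ⊎ ∃ λ s → t ≡ inject₁ s
last-or-inject₁ {zero}  zero    = inj₁ refl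
last-or-inject₁ {suc k} zero    = inj₂ (zero , refl)
last-or-inject₁ {suc k} (suc t) with last-or-inject₁ t
... | inj₁ t≡last     = inj₁ (cong suc t≡last)
... | inj₂ (s , t≡s) = inj₂ (suc s , cong suc t≡s)

-- Krylov sequences v₀, v₁ = a v₀, v₂ = a v₁, … in ℚⁿ.  The goal is prefix-independent:
-- if any K members are independent, then so are v₀, …, v_{K−1}.
module Krylov {n} (a : Fin n → Vector ℚ n) (v : ℕ → Vector ℚ n)
              (step : ∀ j i → v (suc j) i ≡ a i · v j) where

  prefix : ∀ k → Fin k → Vector ℚ n
  prefix k s = v (toℕ s)

  combo-prefix-last : ∀ k (c : Vector ℚ (suc k)) i →
                      combo c (prefix (suc k)) i ≡ combo (c ∘ inject₁) (prefix k) i + c (fromℕ k) * v k i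
  combo-prefix-last k c i = trans (sum-init-last (λ t → c t * prefix (suc k) t i))
    (cong₂ _+_ (sum-cong-≗ (λ s → cong (λ j → c (inject₁ s) * v j i) (FinP.toℕ-inject₁ s)))
               (cong (λ j → c (fromℕ k) * v j i) (FinP.toℕ-fromℕ k)))

  last-inSpan : ∀ k (c : Vector ℚ (suc k)) → (∀ i → combo c (prefix (suc k)) i ≡ 0ℚ) →
                ¬ (c (fromℕ k) ≡ 0ℚ) → InSpan (prefix k) (v k)
  last-inSpan k c relation cₖ≢0 = d , λ i → sym (begin
    combo d (prefix k) i                 ≡⟨ sum-cong-≗ (λ s → ℚP.*-assoc (- z) (c (inject₁ s)) (v (toℕ s) i)) ⟩
    sum (λ s → - z * (c (inject₁ s) * v (toℕ s) i)) ≡⟨ sym (*-distribˡ-sum (- z) (λ s → c (inject₁ s) * v (toℕ s) i)) ⟩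
    - z * combo (c ∘ inject₁) (prefix k) i ≡⟨ cong (- z *_) (rest≡ i) ⟩
    - z * - (cₖ * v k i)                   ≡⟨ solve 3 (λ z c x → (:- z) :* (:- (c :* x)) := (z :* c) :* x) refl z cₖ (v k i) ⟩
    z * cₖ * v k i                         ≡⟨ cong (_* v k i) (ℚP.*-inverseˡ cₖ) ⟩
    1ℚ * v k i                             ≡⟨ ℚP.*-identityˡ (v k i) ⟩
    v k i                                  ∎)
    where
    open ≡-Reasoning
    open +-*-Solver
    cₖ : ℚ
    cₖ = c (fromℕ k)
    instance _ = ≢-nonZero cₖ≢0
    z : ℚ
    z = 1/ cₖ
    d : Vector ℚ k
    d s = - z * c (inject₁ s)
    rest≡ : ∀ i → combo (c ∘ inject₁) (prefix k) i ≡ - (cₖ * v k i)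
    rest≡ i = trans (solve 2 (λ r x → r := (r :+ x) :+ (:- x)) refl (combo (c ∘ inject₁) (prefix k) i) (cₖ * v k i))
                (trans (cong (_+ - (cₖ * v k i)) (trans (sym (combo-prefix-last k c i)) (relation i)))
                       (ℚP.+-identityˡ (- (cₖ * v k i))))

  last-zero : ∀ k (c : Vector ℚ (suc k)) → Independent (prefix k) → (∀ i → combo c (prefix (suc k)) i ≡ 0ℚ) →
              c (fromℕ k) ≡ 0ℚ → ∀ t → c t ≡ 0ℚ
  last-zero k c ind relation cₖ≡0 t with last-or-inject₁ t
  ... | inj₁ t≡last    = trans (cong c t≡last) cₖ≡0
  ... | inj₂ (s , t≡s) = trans (cong c t≡s) (ind (c ∘ inject₁) relation′ s)
    where
    relation′ : ∀ i → combo (c ∘ inject₁) (prefix k) i ≡ 0ℚ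
    relation′ i = begin
      combo (c ∘ inject₁) (prefix k) i                   ≡⟨ sym (ℚP.+-identityʳ _) ⟩
      combo (c ∘ inject₁) (prefix k) i + 0ℚ              ≡⟨ cong (combo (c ∘ inject₁) (prefix k) i +_)
                                                              (sym (trans (cong (_* v k i) cₖ≡0) (ℚP.*-zeroˡ (v k i)))) ⟩
      combo (c ∘ inject₁) (prefix k) i + c (fromℕ k) * v k i ≡⟨ sym (combo-prefix-last k c i) ⟩
      combo c (prefix (suc k)) i                         ≡⟨ relation i ⟩
      0ℚ                                                 ∎
      where open ≡-Reasoning

  -- Once v_k lies in the span of v₀, …, v_{k-1}, so does every member: the span is
  -- mapped by a into itself.
  span-stable : ∀ k → InSpan (prefix k) (v k) → ∀ j → InSpan (prefix k) (v j)
  span-stable k vₖ∈ = member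
    where
    early : ∀ j → j ℕ.≤ k → InSpan (prefix k) (v j)
    early j j≤k with j ℕP.<? k
    ... | yes j<k = subst (InSpan (prefix k) ∘ v) (FinP.toℕ-fromℕ< j<k) (member-inSpan (prefix k) (fromℕ< j<k))
    ... | no  j≮k = subst (InSpan (prefix k) ∘ v) (ℕP.≤-antisym (ℕP.≮⇒≥ j≮k) j≤k) vₖ∈
    member : ∀ j → InSpan (prefix k) (v j)
    member zero    = early zero z≤n
    member (suc j) with member j
    ... | d , vⱼ≡ = InSpan-resp v-suc≡ (combo-inSpan (λ s → v (suc (toℕ s))) (λ s → early _ (FinP.toℕ<n s)) d)
      where
      v-suc≡ : ∀ i → v (suc j) i ≡ combo d (λ s → v (suc (toℕ s))) i
      v-suc≡ i = begin
        v (suc j) i                          ≡⟨ step j i ⟩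
        a i · v j                            ≡⟨ sum-cong-≗ (λ l → cong (a i l *_) (vⱼ≡ l)) ⟩
        a i · combo d (prefix k)             ≡⟨ ·-combo (a i) d (prefix k) ⟩
        sum (λ s → d s * (a i · v (toℕ s)))   ≡⟨ sum-cong-≗ (λ s → cong (d s *_) (sym (step (toℕ s) i))) ⟩
        combo d (λ s → v (suc (toℕ s))) i    ∎
        where open ≡-Reasoning

  prefix-independent : ∀ {K} (cols : Fin K → ℕ) → Independent (v ∘ cols) → ∀ k → k ℕ.≤ K → Independent (prefix k)
  prefix-independent cols ind zero    _   c _ ()
  prefix-independent cols ind (suc k) k<K c relation with c (fromℕ k) ℚP.≟ 0ℚ
  ... | yes cₖ≡0 = last-zero k c (prefix-independent cols ind k (ℕP.<⇒≤ k<K)) relation cₖ≡0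
  ... | no  cₖ≢0 = ⊥-elim (ℕP.<⇒≱ k<K (independent-inSpan⇒≤ (prefix k) (v ∘ cols)
                              (λ t → span-stable k (last-inSpan k c relation cₖ≢0) (cols t)) ind))

square-nonneg : ∀ a → 0ℚ ≤ a * a
square-nonneg a@(mkℚ (ℤ.+ _) _ _)    = ℚP.nonNegative⁻¹ (a * a) {{ℚP.nonNeg*nonNeg⇒nonNeg a a}}
square-nonneg a@(mkℚ ℤ.-[1+ _ ] _ _) = ℚP.nonNegative⁻¹ (a * a) {{ℚP.nonPos*nonPos⇒nonPos a a}}

sum-nonneg : ∀ {m} (f : Vector ℚ m) → (∀ i → 0ℚ ≤ f i) → 0ℚ ≤ sum f
sum-nonneg {zero}  f f≥0 = ℚP.≤-refl
sum-nonneg {suc m} f f≥0 = ℚP.+-mono-≤ (f≥0 zero) (sum-nonneg (f ∘ suc) (f≥0 ∘ suc))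

sum-nonneg-zero : ∀ {m} (f : Vector ℚ m) → (∀ i → 0ℚ ≤ f i) → sum f ≡ 0ℚ → ∀ i → f i ≡ 0ℚ
sum-nonneg-zero {suc m} f f≥0 sum≡0 = terms
  where
  rest≥0 : 0ℚ ≤ sum (f ∘ suc)
  rest≥0 = sum-nonneg (f ∘ suc) (f≥0 ∘ suc)
  head≤0 : f zero ≤ 0ℚ
  head≤0 = subst (f zero ≤_) sum≡0
             (subst (_≤ sum f) (ℚP.+-identityʳ (f zero)) (ℚP.+-monoʳ-≤ (f zero) rest≥0))
  head≡0 : f zero ≡ 0ℚ
  head≡0 = ℚP.≤-antisym head≤0 (f≥0 zero)
  rest≡0 : sum (f ∘ suc) ≡ 0ℚ
  rest≡0 = trans (sym (ℚP.+-identityˡ _)) (trans (cong (_+ sum (f ∘ suc)) (sym head≡0)) sum≡0)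
  terms : ∀ i → f i ≡ 0ℚ
  terms zero    = head≡0
  terms (suc i) = sum-nonneg-zero (f ∘ suc) (f≥0 ∘ suc) rest≡0 i

self-orthogonal⇒zero : ∀ {m} (x : Vector ℚ m) → x · x ≡ 0ℚ → ∀ l → x l ≡ 0ℚ
self-orthogonal⇒zero x x·x≡0 l = decidable-stable (x l ℚP.≟ 0ℚ) λ xₗ≢0 →
  xₗ≢0 (zero-product (x l) (x l) (sum-nonneg-zero (λ l → x l * x l) (λ l → square-nonneg (x l)) x·x≡0 l) xₗ≢0)

orthogonal-to-combo : ∀ {k m} (x : Vector ℚ m) (w : Fin k → Vector ℚ m) → (∀ t → x · w t ≡ 0ℚ) →
                      ∀ c → x · combo c w ≡ 0ℚ
orthogonal-to-combo x w x⊥w c = trans (·-combo x c w)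
  (sum-zero _ (λ t → trans (cong (c t *_) (x⊥w t)) (ℚP.*-zeroʳ (c t))))

-- Two independent vectors x, y orthogonal to an independent family w extend it to
-- an independent family x, y, w: in a relation c₀x + c₁y + U = 0 with U in the span
-- of w, U is orthogonal to itself, hence U = 0.
orthogonal-extension : ∀ {k m} (x y : Vector ℚ m) (w : Fin k → Vector ℚ m) →
                       Independent (x ∷ y ∷ []) → Independent w →
                       (∀ t → x · w t ≡ 0ℚ) → (∀ t → y · w t ≡ 0ℚ) → Independent (x ∷ y ∷ w)
orthogonal-extension {k} {m} x y w xy-ind w-ind x⊥w y⊥w c relation = coefficients
  where
  pair-coefficients : Vector ℚ 2
  pair-coefficients = c zero ∷ c (suc zero) ∷ []
  cw : Vector ℚ k
  cw t = c (suc (suc t))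
  U : Vector ℚ m
  U = combo cw w
  U≡ : ∀ l → U l ≡ combo (λ t → - pair-coefficients t) (x ∷ y ∷ []) l
  U≡ l = trans (solve 5 (λ u a p b q → u := (:- a) :* p :+ ((:- b) :* q :+ con 0ℚ) :+ (a :* p :+ (b :* q :+ u))) refl
                       (U l) (c zero) (x l) (c (suc zero)) (y l))
               (trans (cong (combo (λ t → - pair-coefficients t) (x ∷ y ∷ []) l +_) (relation l)) (ℚP.+-identityʳ _))
    where open +-*-Solver
  U⊥pair : ∀ t → U · (x ∷ y ∷ []) t ≡ 0ℚ
  U⊥pair zero          = trans (·-comm U x) (orthogonal-to-combo x w x⊥w cw)
  U⊥pair (suc zero)    = trans (·-comm U y) (orthogonal-to-combo y w y⊥w cw)
  U≡0 : ∀ l → U l ≡ 0ℚ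
  U≡0 = self-orthogonal⇒zero U (begin
    U · U                                      ≡⟨ sum-cong-≗ (λ l → cong (U l *_) (U≡ l)) ⟩
    U · combo (λ t → - pair-coefficients t) (x ∷ y ∷ [])
      ≡⟨ orthogonal-to-combo U (x ∷ y ∷ []) U⊥pair (λ t → - pair-coefficients t) ⟩
    0ℚ                                         ∎)
    where open ≡-Reasoning
  pair-relation : ∀ l → combo pair-coefficients (x ∷ y ∷ []) l ≡ 0ℚ
  pair-relation l = trans (cong (λ u → c zero * x l + (c (suc zero) * y l + u)) (sym (U≡0 l))) (relation l)
  coefficients : ∀ t → c t ≡ 0ℚ
  coefficients zero          = xy-ind pair-coefficients pair-relation zero
  coefficients (suc zero)    = xy-ind pair-coefficients pair-relation (suc zero)
  coefficients (suc (suc t)) = w-ind cw U≡0 t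

-- Rows i, j of a symmetric matrix with zero diagonal are independent when D i j ≠ 0:
-- evaluating a relation at coordinates i and j isolates each coefficient.
hollow-rows-independent : ∀ {n} (D : Fin n → Vector ℚ n) i j → D i i ≡ 0ℚ → D j j ≡ 0ℚ →
                          D j i ≡ D i j → ¬ (D i j ≡ 0ℚ) → Independent (D i ∷ D j ∷ [])
hollow-rows-independent D i j Dᵢᵢ≡0 Dⱼⱼ≡0 Dⱼᵢ≡Dᵢⱼ Dᵢⱼ≢0 c relation = coefficients
  where
  open +-*-Solver
  drop-zero-terms : ∀ a b → a * 0ℚ + (b + 0ℚ) ≡ b
  drop-zero-terms = solve 2 (λ a b → a :* con 0ℚ :+ (b :+ con 0ℚ) := b) refl
  drop-zero-term : ∀ a b → a + (b * 0ℚ + 0ℚ) ≡ a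
  drop-zero-term = solve 2 (λ a b → a :+ (b :* con 0ℚ :+ con 0ℚ) := a) refl
  at-i : c (suc zero) * D i j ≡ 0ℚ
  at-i = trans (sym (trans (cong₂ (λ p q → c zero * p + (c (suc zero) * q + 0ℚ)) Dᵢᵢ≡0 Dⱼᵢ≡Dᵢⱼ)
                           (drop-zero-terms (c zero) (c (suc zero) * D i j))))
               (relation i)
  at-j : c zero * D i j ≡ 0ℚ
  at-j = trans (sym (trans (cong (λ q → c zero * D i j + (c (suc zero) * q + 0ℚ)) Dⱼⱼ≡0)
                           (drop-zero-term (c zero * D i j) (c (suc zero)))))
               (relation j)
  coefficients : ∀ t → c t ≡ 0ℚ
  coefficients zero       = zero-product (c zero) (D i j) at-j Dᵢⱼ≢0
  coefficients (suc zero) = zero-product (c (suc zero)) (D i j) at-i Dᵢⱼ≢0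

-- A symmetric matrix with zero diagonal whose rows are orthogonal to n − 1 independent
-- vectors of ℚⁿ vanishes: a nonzero entry D i j would give n + 1 independent vectors
-- D i, D j, w₁, …, w_{n−1}.
hollow-annihilator-zero : ∀ {n} (w : Fin (n ∸ 1) → Vector ℚ n) → Independent w →
                          (D : Fin n → Vector ℚ n) → (∀ i → D i i ≡ 0ℚ) → (∀ i j → D i j ≡ D j i) →
                          (∀ i t → D i · w t ≡ 0ℚ) → ∀ i j → D i j ≡ 0ℚ
hollow-annihilator-zero {suc n} w w-ind D diagonal symmetric′ orthogonal i j =
  decidable-stable (D i j ℚP.≟ 0ℚ) λ Dᵢⱼ≢0 →
    ℕP.<-irrefl refl (independent⇒≤ (suc n) (D i ∷ D j ∷ w)
      (orthogonal-extension (D i) (D j) w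
        (hollow-rows-independent D i j (diagonal i) (diagonal j) (symmetric′ j i) Dᵢⱼ≢0)
        w-ind (orthogonal i) (orthogonal j)))

module RowOrder = DecTotalOrder (≤-decTotalOrder ℕP.≤-decTotalOrder)

sort-↭-cong : ∀ {xs ys : List (List ℕ)} → xs ↭ ys → LexSort.sort xs ≡ LexSort.sort ys
sort-↭-cong {xs} {ys} xs↭ys = Pointwise.Pointwise-≡⇒≡ (Pointwise.map Pointwise.Pointwise-≡⇒≡
  (Sorted.↗↭↗⇒≋ RowOrder.totalOrder (LexSort.sort-↗ xs) (LexSort.sort-↗ ys)
    (↭⇒↭ₛ′ RowOrder.isEquivalence (↭-trans (LexSort.sort-↭ xs) (↭-trans xs↭ys (↭-sym (LexSort.sort-↭ ys)))))))

sort-≡⇒↭ : ∀ {xs ys : List (List ℕ)} → LexSort.sort xs ≡ LexSort.sort ys → xs ↭ ys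
sort-≡⇒↭ {xs} {ys} sorts≡ = ↭-trans (↭-sym (LexSort.sort-↭ xs)) (subst (_↭ ys) (sym sorts≡) (LexSort.sort-↭ ys))

tabulate-pull : ∀ {A : Set} {m} (k : Fin (suc m)) (f : Fin (suc m) → A) →
                f k List.∷ List.tabulate (f ∘ punchIn k) ↭ List.tabulate f
tabulate-pull                zero    f = ↭-refl
tabulate-pull {m = suc m} (suc k) f = ↭-trans (↭-swap _ _ ↭-refl) (↭-prep _ (tabulate-pull k (f ∘ suc)))

tabulate-permute : ∀ {A : Set} n (σ : Permutation′ n) (f : Fin n → A) → List.tabulate (f ∘ (σ ⟨$⟩ʳ_)) ↭ List.tabulate f
tabulate-permute zero    σ f = ↭-refl
tabulate-permute (suc m) σ f =
  ↭-trans (↭-prep _ (subst (_↭ List.tabulate (f ∘ punchIn k)) (sym tail≡) (tabulate-permute m σ′ (f ∘ punchIn k))))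
          (tabulate-pull k f)
  where
  k : Fin (suc m)
  k = σ ⟨$⟩ʳ zero
  σ′ : Permutation′ m
  σ′ = Perm.remove zero σ
  tail≡ : List.tabulate (λ i → f (σ ⟨$⟩ʳ suc i)) ≡ List.tabulate (λ i → f (punchIn k (σ′ ⟨$⟩ʳ i)))
  tail≡ = ListP.tabulate-cong (λ i → cong f (Perm.punchIn-permute σ zero i))

tabulate-↭⇒permutation : ∀ {A : Set} {n} (f g : Fin n → A) → List.tabulate f ↭ List.tabulate g →
                         ∃ λ (σ : Permutation′ n) → ∀ i → g (σ ⟨$⟩ʳ i) ≡ f i
tabulate-↭⇒permutation {A} {n} f g f↭g = σ , matches
  where
  open SetoidPermutation (setoid A) using (onIndices-lookup)
  |f| : List.length (List.tabulate f) ≡ n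
  |f| = ListP.length-tabulate f
  |g| : List.length (List.tabulate g) ≡ n
  |g| = ListP.length-tabulate g
  π : Perm.Permutation (List.length (List.tabulate f)) (List.length (List.tabulate g))
  π = onIndices (↭⇒↭ₛ f↭g)
  σ : Permutation′ n
  σ = Perm.cast-id (sym |f|) Perm.∘ₚ (π Perm.∘ₚ Perm.cast-id |g|)
  matches : ∀ i → g (σ ⟨$⟩ʳ i) ≡ f i
  matches i = begin
    g (cast |g| j)                                   ≡⟨ sym (ListP.lookup-tabulate g (cast |g| j)) ⟩
    List.lookup (List.tabulate g) (cast (sym |g|) (cast |g| j)) ≡⟨ cong (List.lookup (List.tabulate g)) (FinP.cast-involutive (sym |g|) |g| j) ⟩
    List.lookup (List.tabulate g) j                            ≡⟨ sym (onIndices-lookup (↭⇒↭ₛ f↭g) (cast (sym |f|) i)) ⟩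
    List.lookup (List.tabulate f) (cast (sym |f|) i)           ≡⟨ ListP.lookup-tabulate f i ⟩
    f i                                              ∎
    where
    open ≡-Reasoning
    j : Fin (List.length (List.tabulate g))
    j = π ⟨$⟩ʳ cast (sym |f|) i

tabulate-injective : ∀ {A : Set} {n} {f g : Fin n → A} → List.tabulate f ≡ List.tabulate g → ∀ i → f i ≡ g i
tabulate-injective {n = suc n} tabs≡ zero    = proj₁ (ListP.∷-injective tabs≡)
tabulate-injective {n = suc n} tabs≡ (suc i) = tabulate-injective (proj₂ (ListP.∷-injective tabs≡)) i

module ℕSum = SemiringSum ℕP.+-*-semiring

sumℕ≡sum : ∀ {n} (f : Fin n → ℕ) → sumℕ f ≡ ℕSum.sum f
sumℕ≡sum {zero}  f = refl
sumℕ≡sum {suc n} f = cong (f zero ℕ.+_) (sumℕ≡sum (f ∘ suc))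

sumℕ-cong : ∀ {n} {f g : Fin n → ℕ} → (∀ i → f i ≡ g i) → sumℕ f ≡ sumℕ g
sumℕ-cong f≗g = cong (List.foldr _ 0) (ListP.tabulate-cong f≗g)

sumℕ-permute : ∀ {n} (σ : Permutation′ n) (f : Fin n → ℕ) → sumℕ (f ∘ (σ ⟨$⟩ʳ_)) ≡ sumℕ f
sumℕ-permute σ f = trans (sumℕ≡sum (f ∘ (σ ⟨$⟩ʳ_))) (trans (sym (ℕSum.∑-permute f σ)) (sym (sumℕ≡sum f)))

bit : Bool → ℕ
bit true  = 1
bit false = 0

bit-injective : ∀ {a b} → bit a ≡ bit b → a ≡ b
bit-injective {true}  {true}  _ = refl
bit-injective {false} {false} _ = refl
bit-injective {true}  {false} ()
bit-injective {false} {true}  ()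

A≡bit : ∀ {n} (G : Graph n) u v → A G u v ≡ bit (adj G u v)
A≡bit G u v with adj G u v
... | true  = refl
... | false = refl

charVec≡bit : ∀ {n} (S : Subset n) v → charVec S v ≡ bit (lookup S v)
charVec≡bit S v with lookup S v
... | true  = refl
... | false = refl

A-symmetric : ∀ {n} (G : Graph n) u v → A G u v ≡ A G v u
A-symmetric G u v = trans (A≡bit G u v) (trans (cong bit (symmetric G u v)) (sym (A≡bit G v u)))

A-loopless : ∀ {n} (G : Graph n) v → A G v v ≡ 0
A-loopless G v = trans (A≡bit G v v) (cong bit (loopless G v))

-- G relabelled along τ: vertex u of relabel τ G plays the role of vertex τ u of G.
-- By definition, g is an automorphism of G iff relabel g G has the adjacency of G.
relabel : ∀ {n} → Permutation′ n → Graph n → Graph n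
relabel τ G = record
  { adj       = λ u v → adj G (τ ⟨$⟩ʳ u) (τ ⟨$⟩ʳ v)
  ; symmetric = λ u v → symmetric G (τ ⟨$⟩ʳ u) (τ ⟨$⟩ʳ v)
  ; loopless  = λ v → loopless G (τ ⟨$⟩ʳ v) }

walk-cong : ∀ {n} (G : Graph n) {x y : Fin n → ℕ} → (∀ i → x i ≡ y i) → ∀ j i → powA G j x i ≡ powA G j y i
walk-cong G x≗y zero    i = x≗y i
walk-cong G x≗y (suc j) i = sumℕ-cong (λ v → cong (A G i v ℕ.*_) (walk-cong G x≗y j v))

walk-graph-cong : ∀ {n} (G H : Graph n) → (∀ u v → adj G u v ≡ adj H u v) →
                  ∀ (x : Fin n → ℕ) j i → powA G j x i ≡ powA H j x i
walk-graph-cong G H adj≡ x zero    i = refl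
walk-graph-cong G H adj≡ x (suc j) i = sumℕ-cong (λ v →
  cong₂ ℕ._*_ (trans (A≡bit G i v) (trans (cong bit (adj≡ i v)) (sym (A≡bit H i v))))
              (walk-graph-cong G H adj≡ x j v))

walk-relabel : ∀ {n} (τ : Permutation′ n) (G : Graph n) (x : Fin n → ℕ) j u →
               powA (relabel τ G) j (x ∘ (τ ⟨$⟩ʳ_)) u ≡ powA G j x (τ ⟨$⟩ʳ u)
walk-relabel τ G x zero    u = refl
walk-relabel τ G x (suc j) u =
  trans (sumℕ-cong (λ v → cong (A G (τ ⟨$⟩ʳ u) (τ ⟨$⟩ʳ v) ℕ.*_) (walk-relabel τ G x j v)))
        (sumℕ-permute τ (λ w → A G (τ ⟨$⟩ʳ u) w ℕ.* powA G j x w))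

walk-automorphism : ∀ {n} (G : Graph n) (τ : Permutation′ n) → IsAutomorphism G τ →
                    ∀ (x : Fin n → ℕ) j u → powA G j (x ∘ (τ ⟨$⟩ʳ_)) u ≡ powA G j x (τ ⟨$⟩ʳ u)
walk-automorphism G τ τ-aut x j u =
  trans (walk-graph-cong G (relabel τ G) (λ v w → sym (τ-aut v w)) _ j u) (walk-relabel τ G x j u)

automorphism-inverse : ∀ {n} (G : Graph n) (g : Permutation′ n) → IsAutomorphism G g → IsAutomorphism G (Perm.flip g)
automorphism-inverse G g g-aut u v =
  trans (sym (g-aut (g ⟨$⟩ˡ u) (g ⟨$⟩ˡ v))) (cong₂ (adj G) (Perm.inverseʳ g) (Perm.inverseʳ g))

image⇔charVec : ∀ {n} (g : Permutation′ n) (S S* : Subset n) →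
                ImageIs g S S* ⇔ (∀ v → charVec S* (g ⟨$⟩ʳ v) ≡ charVec S v)
image⇔charVec g S S* = mk⇔ image⇒charVec charVec⇒image
  where
  bool-ext : ∀ {a b : Bool} → (a ≡ true → b ≡ true) → (b ≡ true → a ≡ true) → a ≡ b
  bool-ext {true}  {true}  _ _ = refl
  bool-ext {false} {false} _ _ = refl
  bool-ext {true}  {false} a⇒b _ = sym (a⇒b refl)
  bool-ext {false} {true}  _ b⇒a = b⇒a refl
  image⇒charVec : ImageIs g S S* → ∀ v → charVec S* (g ⟨$⟩ʳ v) ≡ charVec S v
  image⇒charVec image v = trans (charVec≡bit S* _) (trans (cong bit (bool-ext to from)) (sym (charVec≡bit S v)))
    where
    to : lookup S* (g ⟨$⟩ʳ v) ≡ true → lookup S v ≡ true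
    to gv∈S* with Equivalence.to (image (g ⟨$⟩ʳ v)) (VecP.lookup⇒[]= _ S* gv∈S*)
    ... | u , u∈S , gu≡gv = subst (λ w → lookup S w ≡ true) (trans (sym (Perm.inverseˡ g)) (trans (cong (g ⟨$⟩ˡ_) gu≡gv) (Perm.inverseˡ g))) (VecP.[]=⇒lookup u∈S)
    from : lookup S v ≡ true → lookup S* (g ⟨$⟩ʳ v) ≡ true
    from v∈S = VecP.[]=⇒lookup (Equivalence.from (image (g ⟨$⟩ʳ v)) (v , VecP.lookup⇒[]= v S v∈S , refl))
  charVec⇒image : (∀ v → charVec S* (g ⟨$⟩ʳ v) ≡ charVec S v) → ImageIs g S S*
  charVec⇒image same w = mk⇔ to from
    where
    lookup≡ : ∀ v → lookup S* (g ⟨$⟩ʳ v) ≡ lookup S v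
    lookup≡ v = bit-injective (trans (sym (charVec≡bit S* _)) (trans (same v) (charVec≡bit S v)))
    to : w ∈ S* → ∃ λ v → v ∈ S × g ⟨$⟩ʳ v ≡ w
    to w∈S* = g ⟨$⟩ˡ w , VecP.lookup⇒[]= _ S (trans (sym (lookup≡ (g ⟨$⟩ˡ w)))
                                 (trans (cong (lookup S*) (Perm.inverseʳ g)) (VecP.[]=⇒lookup w∈S*))) , Perm.inverseʳ g
    from : (∃ λ v → v ∈ S × g ⟨$⟩ʳ v ≡ w) → w ∈ S*
    from (v , v∈S , gv≡w) = VecP.lookup⇒[]= w S* (subst (λ u → lookup S* u ≡ true) gv≡w (trans (lookup≡ v) (VecP.[]=⇒lookup v∈S)))

sumℚ≡sum : ∀ {n} (f : Fin n → ℚ) → sumℚ f ≡ sum f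
sumℚ≡sum {zero}  f = refl
sumℚ≡sum {suc n} f = cong (f zero +_) (sumℚ≡sum (f ∘ suc))

toℚ≡mkℚ : ∀ m → toℚ m ≡ mkℚ (ℤ.+ m) 0 (Coprime.sym (Coprime.1-coprimeTo m))
toℚ≡mkℚ m = ℚP.normalize-coprime _

toℚ-+ : ∀ a b → toℚ (a ℕ.+ b) ≡ toℚ a + toℚ b
toℚ-+ a b rewrite toℚ≡mkℚ a | toℚ≡mkℚ b | ℤP.*-identityʳ (ℤ.+ a) | ℤP.*-identityʳ (ℤ.+ b) = refl

toℚ-* : ∀ a b → toℚ (a ℕ.* b) ≡ toℚ a * toℚ b
toℚ-* a b rewrite toℚ≡mkℚ a | toℚ≡mkℚ b | sym (ℤP.pos-* a b) = refl

toℚ-injective : ∀ {a b} → toℚ a ≡ toℚ b → a ≡ b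
toℚ-injective {a} {b} eq = ℤP.+-injective (cong ℚ.numerator (trans (sym (toℚ≡mkℚ a)) (trans eq (toℚ≡mkℚ b))))

toℚ-sumℕ : ∀ {n} (f : Fin n → ℕ) → toℚ (sumℕ f) ≡ sum (toℚ ∘ f)
toℚ-sumℕ {zero}  f = refl
toℚ-sumℕ {suc n} f = trans (toℚ-+ (f zero) _) (cong (toℚ (f zero) +_) (toℚ-sumℕ (f ∘ suc)))

Aℚ : ∀ {n} → Graph n → Fin n → Vector ℚ n
Aℚ G u v = toℚ (A G u v)

walkℚ-step : ∀ {n} (G : Graph n) (x : Fin n → ℕ) j i → toℚ (powA G (suc j) x i) ≡ Aℚ G i · (toℚ ∘ powA G j x)
walkℚ-step G x j i = trans (toℚ-sumℕ (λ v → A G i v ℕ.* powA G j x v)) (sum-cong-≗ (λ v → toℚ-* (A G i v) (powA G j x v)))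

successor-below : ∀ {n k} → k ℕ.< n ∸ 1 → suc k ℕ.< n
successor-below {suc n} k<n-1 = s≤s k<n-1

walkℚ : ∀ {n} → Graph n → Subset n → ℕ → Vector ℚ n
walkℚ G S j = toℚ ∘ powA G j (charVec S)

first-walks-independent : ∀ {n} (G : Graph n) (S : Subset n) → RankAtLeast (walkMatrix G S) (n ∸ 1) →
                          Independent (λ (s : Fin (n ∸ 1)) → walkℚ G S (toℕ s))
first-walks-independent {n} G S (cols , _ , rank) =
  prefix-independent (toℕ ∘ cols) columns-independent (n ∸ 1) ℕP.≤-refl
  where
  open Krylov (Aℚ G) (walkℚ G S) (walkℚ-step G (charVec S))
  columns-independent : Independent (walkℚ G S ∘ toℕ ∘ cols)
  columns-independent c relation =
    rank c (λ i → trans (sumℚ≡sum (λ t → c t * walkℚ G S (toℕ (cols t)) i)) (relation i))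

-- With D = A_H − A_G we have
-- D·A^k e = A^{k+1} e − A^{k+1} e = 0 for k ≤ n − 2; these n − 1 vectors are independent,
-- and D is symmetric with zero diagonal, so D = 0.
walks-determine-graph : ∀ {n} (G H : Graph n) (S : Subset n) → RankAtLeast (walkMatrix G S) (n ∸ 1) →
                        (∀ j → j ℕ.< n → ∀ u → powA H j (charVec S) u ≡ powA G j (charVec S) u) →
                        ∀ u v → adj H u v ≡ adj G u v
walks-determine-graph {n} G H S rank same-walks u v =
  bit-injective (trans (sym (A≡bit H u v)) (trans (toℚ-injective (difference-zero (D≡0 u v))) (A≡bit G u v)))
  where
  e : Fin n → ℕ
  e = charVec S
  D : Fin n → Vector ℚ n
  D i l = Aℚ H i l - Aℚ G i l
  annihilates : ∀ i (t : Fin (n ∸ 1)) → D i · walkℚ G S (toℕ t) ≡ 0ℚ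
  annihilates i t = begin
    D i · walkℚ G S k                            ≡⟨ ·-sub (Aℚ H i) (Aℚ G i) (walkℚ G S k) ⟩
    Aℚ H i · walkℚ G S k - Aℚ G i · walkℚ G S k   ≡⟨ cong (_- Aℚ G i · walkℚ G S k) same-step ⟩
    Aℚ G i · walkℚ G S k - Aℚ G i · walkℚ G S k   ≡⟨ ℚP.+-inverseʳ (Aℚ G i · walkℚ G S k) ⟩
    0ℚ                                           ∎
    where
    open ≡-Reasoning
    k : ℕ
    k = toℕ t
    k+1<n : suc k ℕ.< n
    k+1<n = successor-below (FinP.toℕ<n t)
    same-step : Aℚ H i · walkℚ G S k ≡ Aℚ G i · walkℚ G S k
    same-step = begin
      Aℚ H i · walkℚ G S k           ≡⟨ sum-cong-≗ (λ l → cong (λ w → Aℚ H i l * toℚ w)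
                                                        (sym (same-walks k (ℕP.<-trans (ℕP.n<1+n k) k+1<n) l))) ⟩
      Aℚ H i · (toℚ ∘ powA H k e)    ≡⟨ sym (walkℚ-step H e k i) ⟩
      toℚ (powA H (suc k) e i)       ≡⟨ cong toℚ (same-walks (suc k) k+1<n i) ⟩
      toℚ (powA G (suc k) e i)       ≡⟨ walkℚ-step G e k i ⟩
      Aℚ G i · walkℚ G S k           ∎
  D≡0 : ∀ i j → D i j ≡ 0ℚ
  D≡0 = hollow-annihilator-zero (λ t → walkℚ G S (toℕ t)) (first-walks-independent G S rank) D
          (λ i → cong₂ _-_ (cong toℚ (A-loopless H i)) (cong toℚ (A-loopless G i)))
          (λ i j → cong₂ _-_ (cong toℚ (A-symmetric H i j)) (cong toℚ (A-symmetric G i j)))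
          annihilates

-- (⇒) If g is an automorphism with S^g = S*, then so is g⁻¹ with (S*)^{g⁻¹} = S, and the
-- rows of W^{S*} are the rows of W^S reindexed by g⁻¹; sorting forgets the order.
automorphism⇒lex≡ : ∀ {n} (G : Graph n) (S S* : Subset n) (g : Permutation′ n) →
                    IsAutomorphism G g → ImageIs g S S* → lex (walkMatrix G S) ≡ lex (walkMatrix G S*)
automorphism⇒lex≡ {n} G S S* g g-automorphism image =
  sym (sort-↭-cong (subst (_↭ List.tabulate (row W)) (sym rows≡) (tabulate-permute n ρ (row W))))
  where
  W : Fin n → Fin n → ℕ
  W = walkMatrix G S
  ρ : Permutation′ n
  ρ = Perm.flip g
  S*≡S∘ρ : ∀ i → charVec S* i ≡ charVec S (ρ ⟨$⟩ʳ i)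
  S*≡S∘ρ i = trans (cong (charVec S*) (sym (Perm.inverseʳ g))) (Equivalence.to (image⇔charVec g S S*) image (ρ ⟨$⟩ʳ i))
  rows≡ : List.tabulate (row (walkMatrix G S*)) ≡ List.tabulate (row W ∘ (ρ ⟨$⟩ʳ_))
  rows≡ = ListP.tabulate-cong λ i → ListP.tabulate-cong λ j →
    trans (walk-cong G S*≡S∘ρ (toℕ j) i)
          (walk-automorphism G ρ (automorphism-inverse G g g-automorphism) (charVec S) (toℕ j) i)

-- (⇐) Equal sorted walk matrices give a row permutation σ with W^S(σ i) = W^{S*}(i).
-- Relabelling G along τ = σ⁻¹ preserves the walks from S, so τ is an automorphism by
-- walks-determine-graph, and column 0 shows that τ maps S onto S*.
lex≡⇒automorphism : ∀ {n} (G : Graph n) (S S* : Subset n) → RankAtLeast (walkMatrix G S) (n ∸ 1) →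
                    lex (walkMatrix G S) ≡ lex (walkMatrix G S*) →
                    ∃ λ (g : Permutation′ n) → IsAutomorphism G g × ImageIs g S S*
lex≡⇒automorphism {n} G S S* rank lex≡ =
  τ , walks-determine-graph G (relabel τ G) S rank same-walks , Equivalence.from (image⇔charVec τ S S*) S*∘τ≡S
  where
  e e* : Fin n → ℕ
  e = charVec S
  e* = charVec S*
  rows : ∃ λ (σ : Permutation′ n) → ∀ i → row (walkMatrix G S) (σ ⟨$⟩ʳ i) ≡ row (walkMatrix G S*) i
  rows = tabulate-↭⇒permutation (row (walkMatrix G S*)) (row (walkMatrix G S)) (↭-sym (sort-≡⇒↭ lex≡))
  σ τ : Permutation′ n
  σ = proj₁ rows
  τ = Perm.flip σ
  same-row : ∀ j → j ℕ.< n → ∀ i → powA G j e (σ ⟨$⟩ʳ i) ≡ powA G j e* i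
  same-row j j<n i = subst (λ j → powA G j e (σ ⟨$⟩ʳ i) ≡ powA G j e* i) (FinP.toℕ-fromℕ< j<n)
                           (tabulate-injective (proj₂ rows i) (fromℕ< j<n))
  S*∘τ≡S : ∀ v → e* (τ ⟨$⟩ʳ v) ≡ e v
  S*∘τ≡S v = trans (sym (same-row 0 (ℕP.≤-trans (s≤s z≤n) (FinP.toℕ<n v)) (τ ⟨$⟩ʳ v))) (cong e (Perm.inverseʳ σ))
  same-walks : ∀ j → j ℕ.< n → ∀ u → powA (relabel τ G) j e u ≡ powA G j e u
  same-walks j j<n u = begin
    powA (relabel τ G) j e u                 ≡⟨ walk-cong (relabel τ G) (λ v → sym (S*∘τ≡S v)) j u ⟩
    powA (relabel τ G) j (e* ∘ (τ ⟨$⟩ʳ_)) u   ≡⟨ walk-relabel τ G e* j u ⟩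
    powA G j e* (τ ⟨$⟩ʳ u)                    ≡⟨ sym (same-row j j<n (τ ⟨$⟩ʳ u)) ⟩
    powA G j e (σ ⟨$⟩ʳ (τ ⟨$⟩ʳ u))             ≡⟨ cong (powA G j e) (Perm.inverseʳ σ) ⟩
    powA G j e u                             ∎
    where open ≡-Reasoning

theorem6p4 : ∀ (n : ℕ) (G : Graph n) (S S* : Subset n) →
  Nonempty S →
  RankAtLeast (walkMatrix G S) (n ∸ 1) →
  ((∃ λ (g : Permutation′ n) → IsAutomorphism G g × ImageIs g S S*)
    ⇔ (lex (walkMatrix G S) ≡ lex (walkMatrix G S*)))
theorem6p4 n G S S* _ rank = mk⇔
  (λ (g , g-automorphism , image) → automorphism⇒lex≡ G S S* g g-automorphism image)
  (lex≡⇒automorphism G S S* rank)
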